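{- Let $n$ be an even positive integer with $n=2^{\alpha_1}d$, where $\alpha_1\geq 1$ and $d$ is odd, and assume $d>1$. Then the graph $(K_d\otimes K^*_{n/d})\otimes (K_d\otimes K^*_{n/d})$ (on $n^2$ vertices) is not a circulant graph.
   Context: $K_r$ denotes the complete graph on $r$ vertices (no loops), and $K^*_r$ denotes the complete graph on $r$ vertices with a loop attached at every vertex (adjacency matrix the all-ones matrix). The tensor product $G\otimes H$ of graphs $G$ and $H$ has vertex set $V(G)\times V(H)$, with $(u,u')$ adjacent to $(v,v')$ if and only if $u$ is adjacent to $v$ in $G$ and $u'$ is adjacent to $v'$ in $H$ (adjacency including loops). A graph is circulant if it is isomorphic to a circulant graph $G(N;S)$, i.e. a graph on $\mathbb{Z}_N$ where $i\sim j$ iff $i-j\equiv s\pmod N$ for some $s\in S$, with $S\subseteq\{1,\ldots,N-1\}$, $S=N-S$. -}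

module Defs where

open import Data.Nat using (ℕ; zero; suc; _+_; _∸_; _≤_; _<_; NonZero)
open import Data.Nat.DivMod using (_%_)
open import Data.Bool using (Bool; true; false; not; _∧_)
open import Data.Fin using (Fin; toℕ; _≟_)
open import Data.Product using (Σ; _×_; _,_)
open import Function.Bundles using (_↔_; Inverse)
open import Relation.Nullary.Decidable using (⌊_⌋)
open import Relation.Binary.PropositionalEquality using (_≡_)

-- A graph: a vertex type with a Bool-valued adjacency relation
-- (loops allowed: adj v v may be true).
record Graph : Set₁ where
  field
    V   : Set
    adj : V → V → Bool
open Graph public

K : ℕ → Graph
K r = record { V = Fin r ; adj = λ i j → not ⌊ i ≟ j ⌋ }

K* : ℕ → Graph
K* r = record { V = Fin r ; adj = λ _ _ → true }

_⊗_ : Graph → Graph → Graph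
G ⊗ H = record
  { V   = V G × V H
  ; adj = λ { (u , u′) (v , v′) → adj G u v ∧ adj H u′ v′ } }

record ConnectionSet (N : ℕ) : Set where
  field
    S       : ℕ → Bool
    range   : ∀ k → S k ≡ true → (1 ≤ k × k < N)
    symm    : ∀ k → 1 ≤ k → k < N → S k ≡ S (N ∸ k)
open ConnectionSet public

Circ : (N : ℕ) → .{{_ : NonZero N}} → ConnectionSet N → Graph
Circ N C = record
  { V   = Fin N
  ; adj = λ i j → S C ((toℕ i + (N ∸ toℕ j)) % N) }

record _≅_ (G H : Graph) : Set where
  field
    bij      : V G ↔ V H
    preserve : ∀ u v → adj G u v ≡ adj H (Inverse.to bij u) (Inverse.to bij v)

IsCirculant : Graph → Set
IsCirculant G =
  Σ ℕ λ N → Σ (NonZero N) λ nz → Σ (ConnectionSet N) λ C →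
    G ≅ Circ N {{nz}} C

-- Two vertices of (K_d ⊗ K*_m) ⊗ (K_d ⊗ K*_m) are non-adjacent exactly when their K_d-coordinates
-- lie in a common row or column of the d × d grid. A circulant structure on ℤ_N therefore labels
-- ℤ_N by grid cells so that translations preserve collinearity; they then preserve the cells
-- themselves, since a cell is determined by the cells collinear with it. Using d ≥ 3 one finds u
-- in the row and v in the column of the cell of 0 such that the cell of k is (row of kv, column
-- of ku). Pigeonhole yields q, q′ ≤ d with qu and q′v fixing every cell, so the labelling has a
-- period P < d² and cannot reach all d² cells.

module Submission where

open import Defs
open import Data.Nat using (ℕ; _*_; _^_; _≤_; _<_; NonZero)
open import Data.Nat.DivMod using (_/_)
open import Data.Nat.Divisibility using (_∣_)
open import Relation.Nullary using (¬_)
open import Relation.Binary.PropositionalEquality using (_≡_)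

open import Data.Nat using (zero; suc; _+_; _∸_; z≤n; s≤s; >-nonZero) renaming (_≟_ to _≟ℕ_)
open import Data.Nat.Properties
  using (+-commutativeSemigroup; +-comm; +-assoc; *-assoc; *-suc; *-distribˡ-+; *-distribʳ-+; *-identityʳ;
         m∸n+n≡m; m∸n≤m; m<n⇒0<n∸m; <⇒≤; ≤-trans; <-≤-trans; ≤-<-trans; ≤⇒≯; n<1+n;
         ≤∧≢⇒<; m≤n⇒m<n∨m≡n; m<m*n; *-monoˡ-<; *-monoʳ-<; *-monoˡ-≤; *-monoʳ-≤; m*n≢0; m^n>0)
open import Data.Nat.DivMod
  using (_%_; _mod_; m%n<n; m%n≤n; m≡m%n+[m/n]*n; [m+n]%n≡m%n; [m+kn]%n≡m%n; m<n⇒m%n≡m; m*n/n≡m)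
open import Data.Nat.Divisibility using (divides; m∣m*n; n∣m*n; ∣-refl)
open import Algebra.Properties.CommutativeSemigroup +-commutativeSemigroup using (xy∙z≈yz∙x; xy∙z≈xz∙y)
open import Data.Nat.Tactic.RingSolver using (solve-∀)
open import Data.Bool using (false)
open import Data.Fin using (Fin; zero; suc; toℕ; fromℕ<; _≟_; punchIn; combine; remQuot)
open import Data.Fin.Properties
  using (punchInᵢ≢i; pigeonhole; injective⇒≤; toℕ-fromℕ<; toℕ-injective; toℕ<n; toℕ≤pred[n];
         combine-remQuot)
open import Data.Product using (map₂; ∃; _×_; _,_; proj₁; proj₂; swap; uncurry)
open import Data.Product.Properties using (≡-dec)
open import Data.Sum using (_⊎_; inj₁; inj₂; [_,_])
import Data.Sum as Sum
open import Data.Empty using (⊥-elim)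
open import Function using (id; _∘_; _⇔_; mk⇔; Equivalence; Inverse)
open import Relation.Nullary using (Dec; yes; no; contradiction)
open import Relation.Binary.PropositionalEquality
  using (_≢_; refl; sym; trans; cong; cong₂; subst; subst₂; module ≡-Reasoning)

Cell : ℕ → Set
Cell D = Fin D × Fin D

Collinear : ∀ {D} → Cell D → Cell D → Set
Collinear (a , b) (a′ , b′) = a ≡ a′ ⊎ b ≡ b′

collinear-sym : ∀ {D} {x y : Cell D} → Collinear x y → Collinear y x
collinear-sym = Sum.map sym sym

collinear-⊆⇒≡ : ∀ {n} (x y : Cell (2 + n)) → (∀ z → Collinear x z → Collinear y z) → x ≡ y
collinear-⊆⇒≡ (a , b) (a′ , b′) x⊆y = cong₂ _,_ same-row same-col
  where
  same-row : a ≡ a′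
  same-row with x⊆y (a , punchIn b′ zero) (inj₁ refl)
  ... | inj₁ a′≡a  = sym a′≡a
  ... | inj₂ b′≡b″ = contradiction (sym b′≡b″) (punchInᵢ≢i b′ zero)
  same-col : b ≡ b′
  same-col with x⊆y (punchIn a′ zero , b) (inj₂ refl)
  ... | inj₁ a′≡a″ = contradiction (sym a′≡a″) (punchInᵢ≢i a′ zero)
  ... | inj₂ b′≡b  = sym b′≡b

distinct-from-both : ∀ {n} (x y : Fin (3 + n)) → ∃ λ z → z ≢ x × z ≢ y
distinct-from-both zero          zero          = suc zero , (λ ()) , (λ ())
distinct-from-both zero          (suc zero)    = suc (suc zero) , (λ ()) , (λ ())
distinct-from-both zero          (suc (suc _)) = suc zero , (λ ()) , (λ ())
distinct-from-both (suc zero)    zero          = suc (suc zero) , (λ ()) , (λ ())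
distinct-from-both (suc _)       (suc _)       = zero , (λ ()) , (λ ())
distinct-from-both (suc (suc _)) zero          = suc zero , (λ ()) , (λ ())

periodic-*+ : ∀ {A : Set} {P} (f : ℕ → A) → (∀ k → f (P + k) ≡ f k) → ∀ j k → f (j * P + k) ≡ f k
periodic-*+ f per zero    k = refl
periodic-*+ {P = P} f per (suc j) k = begin
  f (P + j * P + k)   ≡⟨ cong f (+-assoc P (j * P) k) ⟩
  f (P + (j * P + k)) ≡⟨ per (j * P + k) ⟩
  f (j * P + k)       ≡⟨ periodic-*+ f per j k ⟩
  f k                 ∎
  where open ≡-Reasoning

module _ {N : ℕ} .{{_ : NonZero N}} where

  toℕ-mod : ∀ k → toℕ (k mod N) ≡ k % N
  toℕ-mod k = toℕ-fromℕ< (m%n<n k N)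

  mod-periodic : ∀ k → (N + k) mod N ≡ k mod N
  mod-periodic k = toℕ-injective (begin
    toℕ ((N + k) mod N)   ≡⟨ toℕ-mod (N + k) ⟩
    (N + k) % N           ≡⟨ cong (_% N) (+-comm N k) ⟩
    (k + N) % N           ≡⟨ [m+n]%n≡m%n k N ⟩
    k % N                 ≡⟨ toℕ-mod k ⟨
    toℕ (k mod N)         ∎)
    where open ≡-Reasoning

  mod-toℕ : ∀ (i : Fin N) → toℕ i mod N ≡ i
  mod-toℕ i = toℕ-injective (trans (toℕ-mod (toℕ i)) (m<n⇒m%n≡m (toℕ<n i)))

periodic-onto⇒≤ : ∀ {m P} .{{_ : NonZero P}} (f : ℕ → Fin m) →
  (∀ k → f (P + k) ≡ f k) → (∀ x → ∃ λ k → f k ≡ x) → m ≤ P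
periodic-onto⇒≤ {P = P} f per onto = injective⇒≤ {f = λ x → proj₁ (onto x) mod P} injective
  where
  f-% : ∀ k → f (k % P) ≡ f k
  f-% k = begin
    f (k % P)               ≡⟨ periodic-*+ f per (k / P) (k % P) ⟨
    f (k / P * P + k % P)   ≡⟨ cong f (+-comm (k / P * P) (k % P)) ⟩
    f (k % P + k / P * P)   ≡⟨ cong f (m≡m%n+[m/n]*n k P) ⟨
    f k                     ∎
    where open ≡-Reasoning
  injective : ∀ {x y} → proj₁ (onto x) mod P ≡ proj₁ (onto y) mod P → x ≡ y
  injective {x} {y} eq = begin
    x                        ≡⟨ proj₂ (onto x) ⟨
    f (proj₁ (onto x))       ≡⟨ f-% _ ⟨
    f (proj₁ (onto x) % P)   ≡⟨ cong f (trans (sym (toℕ-mod _)) (trans (cong toℕ eq) (toℕ-mod _))) ⟩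
    f (proj₁ (onto y) % P)   ≡⟨ f-% _ ⟩
    f (proj₁ (onto y))       ≡⟨ proj₂ (onto y) ⟩
    y                        ∎
    where open ≡-Reasoning

small-common-multiple : ∀ {D q q′} → 1 < D → 0 < q → q ≤ D → 0 < q′ → q′ ≤ D →
  ∃ λ P → NonZero P × P < D * D × q ∣ P × q′ ∣ P
small-common-multiple {D} {q} {q′} 1<D 0<q q≤D 0<q′ q′≤D with q ≟ℕ q′
... | yes refl = q , >-nonZero 0<q , ≤-<-trans q≤D (m<m*n D D 1<D) , ∣-refl , ∣-refl
  where instance _ = >-nonZero (<-≤-trans 0<q q≤D)
... | no q≢q′ = q * q′ , m*n≢0 q q′ , qq′<DD (m≤n⇒m<n∨m≡n q≤D) (m≤n⇒m<n∨m≡n q′≤D) , m∣m*n q′ , n∣m*n q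
  where
  instance
    _ = >-nonZero 0<q
    _ = >-nonZero 0<q′
  qq′<DD : q < D ⊎ q ≡ D → q′ < D ⊎ q′ ≡ D → q * q′ < D * D
  qq′<DD (inj₁ q<D) _ = <-≤-trans (*-monoˡ-< q′ q<D) (*-monoʳ-≤ D q′≤D)
  qq′<DD (inj₂ _) (inj₁ q′<D) = <-≤-trans (*-monoʳ-< q q′<D) (*-monoˡ-≤ D q≤D)
  qq′<DD (inj₂ q≡D) (inj₂ q′≡D) = contradiction (trans q≡D (sym q′≡D)) q≢q′

-- The labelling of ℤ_N, N = suc M, induced by a circulant structure on the graph: cell k is the
-- pair of K_D-coordinates of the vertex numbered k.
record CyclicRookColouring (D : ℕ) : Set where
  field
    M           : ℕ
    cell        : ℕ → Cell D
    periodic    : ∀ k → cell (suc M + k) ≡ cell k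
    onto        : ∀ x → ∃ λ k → cell k ≡ x
    collinear-+ : ∀ k l s → Collinear (cell k) (cell l) → Collinear (cell (k + s)) (cell (l + s))

transpose : ∀ {D} → CyclicRookColouring D → CyclicRookColouring D
transpose X = record
  { M           = M
  ; cell        = swap ∘ cell
  ; periodic    = cong swap ∘ periodic
  ; onto        = λ x → map₂ (cong swap) (onto (swap x))
  ; collinear-+ = λ k l s → Sum.swap ∘ collinear-+ k l s ∘ Sum.swap
  }
  where open CyclicRookColouring X

module CyclicRookColouringProperties {n} (X : CyclicRookColouring (3 + n)) where
  open CyclicRookColouring X public

  row col : ℕ → Fin (3 + n)
  row = proj₁ ∘ cell
  col = proj₂ ∘ cell

  -- a * M is −a modulo the period suc M.
  neg : ℕ → ℕ
  neg a = a * M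

  cell-+-+neg : ∀ k a → cell (k + a + neg a) ≡ cell k
  cell-+-+neg k a = begin
    cell (k + a + a * M)   ≡⟨ cong cell (xy∙z≈yz∙x k a (a * M)) ⟩
    cell (a + a * M + k)   ≡⟨ cong (λ x → cell (x + k)) (*-suc a M) ⟨
    cell (a * suc M + k)   ≡⟨ periodic-*+ cell periodic a k ⟩
    cell k                 ∎
    where open ≡-Reasoning

  cell-+neg-+ : ∀ k a → cell (k + neg a + a) ≡ cell k
  cell-+neg-+ k a = trans (cong cell (xy∙z≈xz∙y k (neg a) a)) (cell-+-+neg k a)

  infix 4 _∼_
  _∼_ : ℕ → ℕ → Set
  k ∼ l = Collinear (cell k) (cell l)

  ∼-+ : ∀ {k l} s → k ∼ l → k + s ∼ l + s
  ∼-+ s = collinear-+ _ _ s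

  ∼-+⁻ : ∀ {k l} s → k + s ∼ l + s → k ∼ l
  ∼-+⁻ {k} {l} s = subst₂ Collinear (cell-+-+neg k s) (cell-+-+neg l s) ∘ ∼-+ (neg s)

  0∼⇒∼+ : ∀ {x} k → 0 ∼ x → k ∼ k + x
  0∼⇒∼+ {x} k 0∼x = subst (λ y → k ∼ y) (+-comm x k) (∼-+ k 0∼x)

  onto-+ : ∀ s x → ∃ λ j → cell (j + s) ≡ x
  onto-+ s x = let j , cj≡x = onto x in j + neg s , trans (cell-+neg-+ j s) cj≡x

  same-cell-+ : ∀ {k l} s → cell k ≡ cell l → cell (k + s) ≡ cell (l + s)
  same-cell-+ {k} {l} s k≈l = collinear-⊆⇒≡ _ _ shifted
    where
    shifted : ∀ z → Collinear (cell (k + s)) z → Collinear (cell (l + s)) z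
    shifted z k+s∼z = subst (Collinear _) cj+s≡z (∼-+ s l∼j)
      where
      j = proj₁ (onto-+ s z)
      cj+s≡z = proj₂ (onto-+ s z)
      l∼j : l ∼ j
      l∼j = subst (λ c → Collinear c (cell j)) k≈l (∼-+⁻ s (subst (Collinear _) (sym cj+s≡z) k+s∼z))

  same-cell-+⁻ : ∀ {k l} s → cell (k + s) ≡ cell (l + s) → cell k ≡ cell l
  same-cell-+⁻ {k} {l} s = subst₂ _≡_ (cell-+-+neg k s) (cell-+-+neg l s) ∘ same-cell-+ (neg s)

  same-cell-* : ∀ {a b} k → cell a ≡ cell b → cell (k * a) ≡ cell (k * b)
  same-cell-* zero    a≈b = refl
  same-cell-* {a} {b} (suc k) a≈b = begin
    cell (a + k * a)   ≡⟨ cong cell (+-comm a (k * a)) ⟩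
    cell (k * a + a)   ≡⟨ same-cell-+ a (same-cell-* k a≈b) ⟩
    cell (k * b + a)   ≡⟨ cong cell (+-comm (k * b) a) ⟩
    cell (a + k * b)   ≡⟨ same-cell-+ (k * b) a≈b ⟩
    cell (b + k * b)   ∎
    where open ≡-Reasoning

  Period : ℕ → Set
  Period t = cell 0 ≡ cell t

  period? : ∀ t → Dec (Period t)
  period? t = ≡-dec _≟_ _≟_ (cell 0) (cell t)

  period-+ˡ : ∀ {t} → Period t → ∀ k → cell (t + k) ≡ cell k
  period-+ˡ pt k = sym (same-cell-+ k pt)

  period-+ʳ : ∀ {t} → Period t → ∀ k → cell (k + t) ≡ cell k
  period-+ʳ {t} pt k = trans (cong cell (+-comm k t)) (period-+ˡ pt k)

  period-* : ∀ {t} k → Period t → Period (k * t)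
  period-* zero        _  = refl
  period-* {t} (suc k) pt = trans (period-* k pt) (same-cell-+ (k * t) pt)

  same-cell⇒period : ∀ {k t} → cell k ≡ cell (k + t) → Period t
  same-cell⇒period {k} {t} k≈k+t = same-cell-+⁻ k (trans k≈k+t (cong cell (+-comm k t)))

  Row₀ Col₀ : ℕ → Set
  Row₀ x = row 0 ≡ row x
  Col₀ x = col 0 ≡ col x

  period⊎row₀-col₀-cell : ∀ {u v} → Row₀ u → Col₀ v → ¬ Period u → ¬ Period v →
                Period (u + v) ⊎ cell (u + v) ≡ (row v , col u)
  period⊎row₀-col₀-cell {u} {v} ru cv ¬pu ¬pv
    with 0∼⇒∼+ u (inj₂ cv) | subst (v ∼_) (+-comm v u) (0∼⇒∼+ v (inj₁ ru))
  ... | inj₁ r | inj₁ r′ = contradiction (cong₂ _,_ (trans ru (trans r (sym r′))) cv) ¬pv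
  ... | inj₁ r | inj₂ c′ = inj₁ (cong₂ _,_ (trans ru r) (trans cv c′))
  ... | inj₂ c | inj₁ r′ = inj₂ (cong₂ _,_ (sym r′) (sym c))
  ... | inj₂ c | inj₂ c′ = contradiction (cong₂ _,_ ru (trans cv (trans c′ (sym c)))) ¬pu

  ∼⇒0∼-neg : ∀ {u b} → u ∼ b → 0 ∼ b + neg u
  ∼⇒0∼-neg {u} {b} u∼b = subst (λ c → Collinear c (cell (b + neg u))) (cell-+-+neg 0 u) (∼-+ (neg u) u∼b)

  0∼⇒0∼neg : ∀ {u} → 0 ∼ u → 0 ∼ neg u
  0∼⇒0∼neg = ∼⇒0∼-neg ∘ collinear-sym

  -- b lies in the row of 0 but in neither the column of 0 nor that of u: this needs D ≥ 3.
  row₀-col₀-neg⇒period : ∀ {u} → Row₀ u → Col₀ (neg u) → Period (neg u)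
  row₀-col₀-neg⇒period {u} ru cnu with period? (neg u)
  ... | yes pnu  = pnu
  ... | no  ¬pnu = cong₂ _,_ rnu cnu
    where
    z = distinct-from-both (col 0) (col u)
    b = proj₁ (onto (row 0 , proj₁ z))
    rb : Row₀ b
    rb = cong proj₁ (sym (proj₂ (onto (row 0 , proj₁ z))))
    colb : col b ≡ proj₁ z
    colb = cong proj₂ (proj₂ (onto (row 0 , proj₁ z)))
    rnu : Row₀ (neg u)
    rnu with period⊎row₀-col₀-cell rb cnu (λ pb → proj₁ (proj₂ z) (trans (sym colb) (sym (cong proj₂ pb)))) ¬pnu
    ... | inj₁ pb-u = contradiction (trans (sym colb) (cong proj₂ (sym u≈b))) (proj₂ (proj₂ z))
      where
      u≈b : cell u ≡ cell b
      u≈b = trans (same-cell-+ u pb-u) (cell-+neg-+ b u)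
    ... | inj₂ cb-u =
      [ (λ r → trans r (cong proj₁ cb-u))
      , (λ c → contradiction (trans (sym colb) (sym (trans c (cong proj₂ cb-u)))) (proj₁ (proj₂ z)))
      ] (∼⇒0∼-neg (inj₁ (trans (sym ru) rb)))

  row₀-neg : ∀ {u} → Row₀ u → Row₀ (neg u)
  row₀-neg ru = [ id , cong proj₁ ∘ row₀-col₀-neg⇒period ru ] (0∼⇒0∼neg (inj₁ ru))

  row₀-col₀-cell : ∀ {u v} → Row₀ u → Col₀ v → cell (u + v) ≡ (row v , col u)
  row₀-col₀-cell {u} {v} ru cv with period? u | period? v
  ... | yes pu | _ = cong₂ _,_ (cong proj₁ u+v≈v) (trans (cong proj₂ u+v≈v) (trans (sym cv) (cong proj₂ pu)))
    where u+v≈v = period-+ˡ pu v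
  ... | no _ | yes pv = cong₂ _,_ (trans (cong proj₁ u+v≈u) (trans (sym ru) (cong proj₁ pv))) (cong proj₂ u+v≈u)
    where u+v≈u = period-+ʳ pv u
  ... | no ¬pu | no ¬pv with period⊎row₀-col₀-cell ru cv ¬pu ¬pv
  ...   | inj₂ u+v≈ = u+v≈
  ...   | inj₁ pu+v = contradiction (cong₂ _,_ (trans (row₀-neg ru) (cong proj₁ -u≈v)) cv) ¬pv
    where
    -u≈v : cell (neg u) ≡ cell v
    -u≈v = begin
      cell (neg u)             ≡⟨ period-+ˡ pu+v (neg u) ⟨
      cell (u + v + neg u)     ≡⟨ cong (λ x → cell (x + neg u)) (+-comm u v) ⟩
      cell (v + u + neg u)     ≡⟨ cell-+-+neg v u ⟩
      cell v                   ∎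
      where open ≡-Reasoning

  row₀-+ : ∀ {x y} → Row₀ x → Row₀ y → Row₀ (x + y)
  row₀-+ {x} {y} rx ry with 0∼⇒∼+ x (inj₁ ry)
  ... | inj₁ r = trans rx r
  ... | inj₂ c = b∼y⇒row₀ (∼-+⁻ x (subst₂ _∼_ (+-comm x b) (+-comm x y) (inj₂ (trans (cong proj₂ x+b≈) c))))
    where
    b = proj₁ (onto (punchIn (row 0) zero , col 0))
    cb : cell b ≡ (punchIn (row 0) zero , col 0)
    cb = proj₂ (onto (punchIn (row 0) zero , col 0))
    x+b≈ : cell (x + b) ≡ (row b , col x)
    x+b≈ = row₀-col₀-cell rx (cong proj₂ (sym cb))
    b∼y⇒row₀ : b ∼ y → Row₀ (x + y)
    b∼y⇒row₀ (inj₁ r) = contradiction (trans (sym (cong proj₁ cb)) (trans r (sym ry))) (punchInᵢ≢i (row 0) zero)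
    b∼y⇒row₀ (inj₂ c′) = trans rx (cong proj₁ (sym (period-+ʳ (cong₂ _,_ ry (trans (cong proj₂ (sym cb)) c′)) x)))

  row₀-* : ∀ {u} k → Row₀ u → Row₀ (k * u)
  row₀-* zero    ru = refl
  row₀-* (suc k) ru = row₀-+ ru (row₀-* k ru)

  row₀⇒period-multiple : ∀ {u} → Row₀ u → ∃ λ q → 0 < q × q ≤ 3 + n × Period (q * u)
  row₀⇒period-multiple {u} ru with pigeonhole (n<1+n (3 + n)) (λ i → col (toℕ i * u))
  ... | i , j , i<j , same-col =
    toℕ j ∸ toℕ i , m<n⇒0<n∸m i<j , ≤-trans (m∸n≤m (toℕ j) (toℕ i)) (toℕ≤pred[n] j) , same-cell⇒period twins
    where
    twins : cell (toℕ i * u) ≡ cell (toℕ i * u + (toℕ j ∸ toℕ i) * u)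
    twins = begin
      cell (toℕ i * u)                         ≡⟨ cong₂ _,_ (trans (sym (row₀-* (toℕ i) ru)) (row₀-* (toℕ j) ru)) same-col ⟩
      cell (toℕ j * u)                         ≡⟨ cong (λ m → cell (m * u)) (m∸n+n≡m (<⇒≤ i<j)) ⟨
      cell ((toℕ j ∸ toℕ i + toℕ i) * u)       ≡⟨ cong cell (*-distribʳ-+ u (toℕ j ∸ toℕ i) (toℕ i)) ⟩
      cell ((toℕ j ∸ toℕ i) * u + toℕ i * u)   ≡⟨ cong cell (+-comm ((toℕ j ∸ toℕ i) * u) (toℕ i * u)) ⟩
      cell (toℕ i * u + (toℕ j ∸ toℕ i) * u)   ∎
      where open ≡-Reasoning

  period-∣ : ∀ {q P u} → q ∣ P → Period (q * u) → Period (P * u)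
  period-∣ {q} {u = u} (divides a refl) pqu = subst Period (sym (*-assoc a q u)) (period-* a pqu)

cell-period⇒≤ : ∀ {D P} .{{_ : NonZero P}} (X : CyclicRookColouring D) →
  (∀ k → CyclicRookColouring.cell X (P + k) ≡ CyclicRookColouring.cell X k) → D * D ≤ P
cell-period⇒≤ {D} X per = periodic-onto⇒≤ (uncurry combine ∘ cell) (cong (uncurry combine) ∘ per) onto′
  where
  open CyclicRookColouring X
  onto′ : ∀ i → ∃ λ k → uncurry combine (cell k) ≡ i
  onto′ i = map₂ (λ ck≡ → trans (cong (uncurry combine) ck≡) (combine-remQuot {D} D i)) (onto (remQuot {D} D i))

module _ {n} (X : CyclicRookColouring (3 + n)) where
  open CyclicRookColouringProperties X
  private module ᵀ = CyclicRookColouringProperties (transpose X)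

  cell-in-multiples : ∃ λ u → ∃ λ v → Row₀ u × Col₀ v × ∀ k → cell k ≡ (row (k * v) , col (k * u))
  cell-in-multiples = u , v , ru , cv , cell≡
    where
    u = proj₁ (onto (row 0 , col 1))
    v = proj₁ (onto (row 1 , col 0))
    cu : cell u ≡ (row 0 , col 1)
    cu = proj₂ (onto (row 0 , col 1))
    cv′ : cell v ≡ (row 1 , col 0)
    cv′ = proj₂ (onto (row 1 , col 0))
    ru : Row₀ u
    ru = cong proj₁ (sym cu)
    cv : Col₀ v
    cv = cong proj₂ (sym cv′)
    1≈u+v : cell 1 ≡ cell (u + v)
    1≈u+v = sym (trans (row₀-col₀-cell ru cv) (cong₂ _,_ (cong proj₁ cv′) (cong proj₂ cu)))
    cell≡ : ∀ k → cell k ≡ (row (k * v) , col (k * u))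
    cell≡ k = begin
      cell k                 ≡⟨ cong cell (*-identityʳ k) ⟨
      cell (k * 1)           ≡⟨ same-cell-* k 1≈u+v ⟩
      cell (k * (u + v))     ≡⟨ cong cell (*-distribˡ-+ k u v) ⟩
      cell (k * u + k * v)   ≡⟨ row₀-col₀-cell (row₀-* k ru) (ᵀ.row₀-* k cv) ⟩
      (row (k * v) , col (k * u)) ∎
      where open ≡-Reasoning

  cell-period-from-multiples : ∀ {u v P} → (∀ k → cell k ≡ (row (k * v) , col (k * u))) →
                     Period (P * u) → Period (P * v) → ∀ k → cell (P + k) ≡ cell k
  cell-period-from-multiples {u} {v} {P} cell≡ pPu pPv k = begin
    cell (P + k)                               ≡⟨ cell≡ (P + k) ⟩
    (row ((P + k) * v) , col ((P + k) * u))   ≡⟨ cong₂ _,_ (cong proj₁ (shift pPv)) (cong proj₂ (shift pPu)) ⟩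
    (row (k * v) , col (k * u))               ≡⟨ cell≡ k ⟨
    cell k                                     ∎
    where
    open ≡-Reasoning
    shift : ∀ {w} → Period (P * w) → cell ((P + k) * w) ≡ cell (k * w)
    shift {w} pPw = trans (cong cell (*-distribʳ-+ w P k)) (period-+ˡ pPw (k * w))

  short-cell-period : ∃ λ P → NonZero P × P < (3 + n) * (3 + n) × ∀ k → cell (P + k) ≡ cell k
  short-cell-period =
    let u , v , ru , cv , cell≡           = cell-in-multiples
        q , 0<q , q≤D , pqu              = row₀⇒period-multiple ru
        q′ , 0<q′ , q′≤D , pq′v          = ᵀ.row₀⇒period-multiple cv
        P , nzP , P<DD , q∣P , q′∣P       = small-common-multiple (s≤s (s≤s z≤n)) 0<q q≤D 0<q′ q′≤D
    in P , nzP , P<DD , cell-period-from-multiples cell≡ (period-∣ q∣P pqu) (cong swap (ᵀ.period-∣ q′∣P pq′v))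

no-cyclic-rook-colouring : ∀ {D} → 3 ≤ D → ¬ CyclicRookColouring D
no-cyclic-rook-colouring (s≤s (s≤s (s≤s _))) X =
  let P , nzP , P<DD , per = short-cell-period X in ≤⇒≯ (cell-period⇒≤ {{nzP}} X per) P<DD

module _ (M : ℕ) where
  private
    N = suc M

  [m%N+[N∸n%N]]%N≡[m+n*M]%N : ∀ m n → (m % N + (N ∸ n % N)) % N ≡ (m + n * M) % N
  [m%N+[N∸n%N]]%N≡[m+n*M]%N m n = begin
    (a + (N ∸ b)) % N                         ≡⟨ [m+kn]%n≡m%n (a + (N ∸ b)) b N ⟨
    (a + (N ∸ b) + b * N) % N                 ≡⟨ cong (_% N) (rearrange a (N ∸ b) b M) ⟩
    (a + b * M + (N ∸ b + b)) % N             ≡⟨ cong (λ t → (a + b * M + t) % N) (m∸n+n≡m (m%n≤n n N)) ⟩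
    (a + b * M + N) % N                       ≡⟨ [m+n]%n≡m%n (a + b * M) N ⟩
    (a + b * M) % N                           ≡⟨ [m+kn]%n≡m%n (a + b * M) (m / N + n / N * M) N ⟨
    (a + b * M + (m / N + n / N * M) * N) % N ≡⟨ cong (_% N) (regroup a b (m / N) (n / N) M) ⟩
    ((a + m / N * N) + (b + n / N * N) * M) % N
      ≡⟨ cong₂ (λ x y → (x + y * M) % N) (m≡m%n+[m/n]*n m N) (m≡m%n+[m/n]*n n N) ⟨
    (m + n * M) % N                           ∎
    where
    open ≡-Reasoning
    a = m % N
    b = n % N
    rearrange : ∀ a t b M → a + t + b * suc M ≡ a + b * M + (t + b)
    rearrange = solve-∀
    regroup : ∀ a b x y M → a + b * M + (x + y * M) * suc M ≡ a + x * suc M + (b + y * suc M) * M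
    regroup = solve-∀

  Circ-adj-+ : ∀ (C : ConnectionSet N) k l s →
    adj (Circ N C) ((k + s) mod N) ((l + s) mod N) ≡ adj (Circ N C) (k mod N) (l mod N)
  Circ-adj-+ C k l s = cong (S C) (begin
    (toℕ ((k + s) mod N) + (N ∸ toℕ ((l + s) mod N))) % N
      ≡⟨ cong₂ (λ x y → (x + (N ∸ y)) % N) (toℕ-mod (k + s)) (toℕ-mod (l + s)) ⟩
    ((k + s) % N + (N ∸ (l + s) % N)) % N   ≡⟨ [m%N+[N∸n%N]]%N≡[m+n*M]%N (k + s) (l + s) ⟩
    (k + s + (l + s) * M) % N               ≡⟨ cong (_% N) (rearrange k s l M) ⟩
    (k + l * M + s * N) % N                 ≡⟨ [m+kn]%n≡m%n (k + l * M) s N ⟩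
    (k + l * M) % N                         ≡⟨ [m%N+[N∸n%N]]%N≡[m+n*M]%N k l ⟨
    (k % N + (N ∸ l % N)) % N
      ≡⟨ cong₂ (λ x y → (x + (N ∸ y)) % N) (toℕ-mod k) (toℕ-mod l) ⟨
    (toℕ (k mod N) + (N ∸ toℕ (l mod N))) % N ∎)
    where
    open ≡-Reasoning
    rearrange : ∀ k s l M → k + s + (l + s) * M ≡ k + l * M + s * suc M
    rearrange = solve-∀

module _ {D p : ℕ} where
  private
    H = (K D ⊗ K* p) ⊗ (K D ⊗ K* p)

  grid : V H → Cell D
  grid ((a , _) , (b , _)) = a , b

  non-adjacent⇔collinear : ∀ x y → adj H x y ≡ false ⇔ Collinear (grid x) (grid y)
  non-adjacent⇔collinear ((a , _) , (b , _)) ((a′ , _) , (b′ , _)) with a ≟ a′ | b ≟ b′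
  ... | yes a≡a′ | _        = mk⇔ (λ _ → inj₁ a≡a′) (λ _ → refl)
  ... | no _     | yes b≡b′ = mk⇔ (λ _ → inj₂ b≡b′) (λ _ → refl)
  ... | no a≢a′  | no b≢b′  = mk⇔ (λ ()) (⊥-elim ∘ [ a≢a′ , b≢b′ ])

  circulant⇒cyclicRookColouring : 0 < p → IsCirculant H → CyclicRookColouring D
  circulant⇒cyclicRookColouring 0<p (suc M , _ , C , iso) = record
    { M           = M
    ; cell        = cell
    ; periodic    = cong (grid ∘ from) ∘ mod-periodic
    ; onto        = λ x → toℕ (to (vertex x)) , cong grid (trans (cong from (mod-toℕ _)) (strictlyInverseʳ (vertex x)))
    ; collinear-+ = collinear-+
    }
    where
    open _≅_ iso
    open Inverse bij
    N = suc M
    at : ℕ → V H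
    at k = from (k mod N)
    cell : ℕ → Cell D
    cell = grid ∘ at
    vertex : Cell D → V H
    vertex (a , b) = (a , fromℕ< 0<p) , (b , fromℕ< 0<p)
    adj-at : ∀ k l → adj H (at k) (at l) ≡ adj (Circ N C) (k mod N) (l mod N)
    adj-at k l = trans (preserve (at k) (at l)) (cong₂ (adj (Circ N C)) (strictlyInverseˡ _) (strictlyInverseˡ _))
    collinear-+ : ∀ k l s → Collinear (cell k) (cell l) → Collinear (cell (k + s)) (cell (l + s))
    collinear-+ k l s kl = Equivalence.to (non-adjacent⇔collinear (at (k + s)) (at (l + s))) (begin
      adj H (at (k + s)) (at (l + s))                 ≡⟨ adj-at (k + s) (l + s) ⟩
      adj (Circ N C) ((k + s) mod N) ((l + s) mod N)  ≡⟨ Circ-adj-+ M C k l s ⟩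
      adj (Circ N C) (k mod N) (l mod N)              ≡⟨ adj-at k l ⟨
      adj H (at k) (at l)                             ≡⟨ Equivalence.from (non-adjacent⇔collinear (at k) (at l)) kl ⟩
      false                                           ∎)
      where open ≡-Reasoning

theorem4p2 : (n α₁ d : ℕ) → .{{_ : NonZero d}} →
    n ≡ 2 ^ α₁ * d → 1 ≤ α₁ → ¬ (2 ∣ d) → 1 < d →
    ¬ IsCirculant ((K d ⊗ K* (n / d)) ⊗ (K d ⊗ K* (n / d)))
theorem4p2 n α₁ d n≡2^α₁*d _ 2∤d 1<d =
  no-cyclic-rook-colouring 3≤d ∘ circulant⇒cyclicRookColouring 0<n/d
  where
  3≤d : 3 ≤ d
  3≤d = ≤∧≢⇒< 1<d (λ 2≡d → 2∤d (subst (2 ∣_) 2≡d ∣-refl))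
  0<n/d : 0 < n / d
  0<n/d = subst (0 <_) (sym (trans (cong (_/ d) n≡2^α₁*d) (m*n/n≡m (2 ^ α₁) d))) (m^n>0 2 α₁)
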